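{- Let $\mathbf{U}=(\mathbf{T},G,H)$ be a tense centered KI-algebra, with $F(x):=\sim G(\sim x)$ and $P(x):=\sim H(\sim x)$. Then for all $x\in T$: (c1) $F(c)=c$ and $P(c)=c$; (c2) $G(x\vee c)=G(x)\vee c$ and $H(x\vee c)=H(x)\vee c$; (c3) $F(x\wedge c)=F(x)\wedge c$ and $P(x\wedge c)=P(x)\wedge c$.
   Context: A centered Kleene algebra is $\langle T,\wedge,\vee,\sim,c,0,1\rangle$ with bounded distributive lattice reduct, $\sim\sim x=x$, $\sim(x\vee y)=\sim x\wedge\sim y$, $x\wedge\sim x\le y\vee\sim y$, $\sim c=c$. A KI-algebra is $\langle T,\wedge,\vee,\Rightarrow,\sim,c,0,1\rangle$ with centered Kleene reduct such that: $(a\Rightarrow b)\wedge(a\Rightarrow d)=a\Rightarrow(b\wedge d)$, $(a\Rightarrow d)\wedge(b\Rightarrow d)=(a\vee b)\Rightarrow d$, $0\Rightarrow a=1$, $a\Rightarrow 1=1$; $(x\wedge(x\Rightarrow y))\vee c\le y\vee c$; $c\Rightarrow c=1$; $(x\Rightarrow y)\wedge c=(\sim x\vee y)\wedge c$; $(x\Rightarrow\sim y)\vee c=(x\Rightarrow(\sim y\vee c))\wedge(y\Rightarrow(\sim x\vee c))$. A tense KI-algebra is $(\mathbf{T},G,H)$ with $G,H$ unary satisfying: $G(1)=H(1)=1$; $G(x\wedge y)=G(x)\wedge G(y)$, $H(x\wedge y)=H(x)\wedge H(y)$; $x\le GP(x)$, $x\le HF(x)$; $G(x\vee y)\le G(x)\vee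 F(y)$, $H(x\vee y)\le H(x)\vee P(y)$; $G(x\Rightarrow y)\le G(x)\Rightarrow G(y)$, $H(x\Rightarrow y)\le H(x)\Rightarrow H(y)$; $G(x\Rightarrow y)\le F(x)\Rightarrow F(y)$, $H(x\Rightarrow y)\le P(x)\Rightarrow P(y)$. It is centered if moreover $G(c)=c=H(c)$. -}

module Defs where

open import Level using (Level; suc)
open import Relation.Binary.PropositionalEquality using (_≡_)

record KIAlgebra (ℓ : Level) : Set (suc ℓ) where
  infixr 6 _∧_
  infixr 5 _∨_
  infixr 4 _⇒_
  field
    T   : Set ℓ
    _∧_ : T → T → T
    _∨_ : T → T → T
    _⇒_ : T → T → T
    ∼   : T → T
    c   : T
    𝟘   : T
    𝟙   : T

  _≤_ : T → T → Set ℓ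
  x ≤ y = (x ∧ y) ≡ x

  field
    ∧-assoc  : ∀ x y z → ((x ∧ y) ∧ z) ≡ (x ∧ (y ∧ z))
    ∨-assoc  : ∀ x y z → ((x ∨ y) ∨ z) ≡ (x ∨ (y ∨ z))
    ∧-comm   : ∀ x y → (x ∧ y) ≡ (y ∧ x)
    ∨-comm   : ∀ x y → (x ∨ y) ≡ (y ∨ x)
    ∧-absorb : ∀ x y → (x ∧ (x ∨ y)) ≡ x
    ∨-absorb : ∀ x y → (x ∨ (x ∧ y)) ≡ x
    ∧-distrib-∨ : ∀ x y z → (x ∧ (y ∨ z)) ≡ ((x ∧ y) ∨ (x ∧ z))
    𝟘-least  : ∀ x → (𝟘 ∨ x) ≡ x
    𝟙-greatest : ∀ x → (𝟙 ∧ x) ≡ x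
    ∼-invol  : ∀ x → ∼ (∼ x) ≡ x
    ∼-deMorgan : ∀ x y → ∼ (x ∨ y) ≡ (∼ x ∧ ∼ y)
    kleene   : ∀ x y → (x ∧ ∼ x) ≤ (y ∨ ∼ y)
    ∼-c      : ∼ c ≡ c
    ⇒-∧ʳ : ∀ a b d → ((a ⇒ b) ∧ (a ⇒ d)) ≡ (a ⇒ (b ∧ d))
    ⇒-∨ˡ : ∀ a b d → ((a ⇒ d) ∧ (b ⇒ d)) ≡ ((a ∨ b) ⇒ d)
    𝟘⇒   : ∀ a → (𝟘 ⇒ a) ≡ 𝟙
    ⇒𝟙   : ∀ a → (a ⇒ 𝟙) ≡ 𝟙
    mp-c : ∀ x y → ((x ∧ (x ⇒ y)) ∨ c) ≤ (y ∨ c)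
    c⇒c  : (c ⇒ c) ≡ 𝟙
    ⇒-c  : ∀ x y → ((x ⇒ y) ∧ c) ≡ ((∼ x ∨ y) ∧ c)
    ⇒-∼  : ∀ x y → ((x ⇒ ∼ y) ∨ c) ≡ ((x ⇒ (∼ y ∨ c)) ∧ (y ⇒ (∼ x ∨ c)))

record TenseKIAlgebra (ℓ : Level) : Set (suc ℓ) where
  field
    𝐓 : KIAlgebra ℓ
  open KIAlgebra 𝐓
  field
    G : T → T
    H : T → T

  F : T → T
  F x = ∼ (G (∼ x))

  P : T → T
  P x = ∼ (H (∼ x))

  field
    G𝟙 : G 𝟙 ≡ 𝟙
    H𝟙 : H 𝟙 ≡ 𝟙
    G-∧ : ∀ x y → G (x ∧ y) ≡ (G x ∧ G y)
    H-∧ : ∀ x y → H (x ∧ y) ≡ (H x ∧ H y)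
    x≤GP : ∀ x → x ≤ G (P x)
    x≤HF : ∀ x → x ≤ H (F x)
    G-∨ : ∀ x y → G (x ∨ y) ≤ (G x ∨ F y)
    H-∨ : ∀ x y → H (x ∨ y) ≤ (H x ∨ P y)
    G-⇒ : ∀ x y → G (x ⇒ y) ≤ (G x ⇒ G y)
    H-⇒ : ∀ x y → H (x ⇒ y) ≤ (H x ⇒ H y)
    G-⇒F : ∀ x y → G (x ⇒ y) ≤ (F x ⇒ F y)
    H-⇒P : ∀ x y → H (x ⇒ y) ≤ (P x ⇒ P y)

record CenteredTenseKIAlgebra (ℓ : Level) : Set (suc ℓ) where
  field
    𝐔 : TenseKIAlgebra ℓ
  open TenseKIAlgebra 𝐔
  open KIAlgebra 𝐓
  field
    Gc : G c ≡ c
    Hc : H c ≡ c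

-- Since ∼ c = c, the centering G c = c gives F c = ∼ G (∼ c) = c.  Then
-- G (x ∨ c) ≤ G x ∨ F c = G x ∨ c by the tense axiom for joins, while
-- G x ∨ c = G x ∨ G c ≤ G (x ∨ c) by monotonicity of G.  The statement
-- for F is the De Morgan dual of the one for G, and H, P behave exactly
-- like G, F.
module Submission where

open import Defs
open import Data.Product using (_×_; _,_)
open import Relation.Binary.PropositionalEquality
  using (_≡_; sym; trans; cong; cong₂; module ≡-Reasoning)

module KIAlgebraProperties {ℓ} (K : KIAlgebra ℓ) where
  open KIAlgebra K
  open ≡-Reasoning

  ≤-antisym : ∀ {x y} → x ≤ y → y ≤ x → x ≡ y
  ≤-antisym {x} {y} x≤y y≤x = trans (sym x≤y) (trans (∧-comm x y) y≤x)

  x≤x∨y : ∀ x y → x ≤ (x ∨ y)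
  x≤x∨y = ∧-absorb

  y≤x∨y : ∀ x y → y ≤ (x ∨ y)
  y≤x∨y x y = trans (cong (y ∧_) (∨-comm x y)) (∧-absorb y x)

  ∨-least : ∀ {x y z} → x ≤ z → y ≤ z → (x ∨ y) ≤ z
  ∨-least {x} {y} {z} x≤z y≤z = begin
    (x ∨ y) ∧ z        ≡⟨ ∧-comm (x ∨ y) z ⟩
    z ∧ (x ∨ y)        ≡⟨ ∧-distrib-∨ z x y ⟩
    (z ∧ x) ∨ (z ∧ y)  ≡⟨ cong₂ _∨_ (trans (∧-comm z x) x≤z) (trans (∧-comm z y) y≤z) ⟩
    x ∨ y              ∎

  ∼-deMorgan-∧ : ∀ x y → ∼ (x ∧ y) ≡ (∼ x ∨ ∼ y)
  ∼-deMorgan-∧ x y = begin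
    ∼ (x ∧ y)              ≡⟨ cong ∼ (sym (cong₂ _∧_ (∼-invol x) (∼-invol y))) ⟩
    ∼ (∼ (∼ x) ∧ ∼ (∼ y))  ≡⟨ cong ∼ (sym (∼-deMorgan (∼ x) (∼ y))) ⟩
    ∼ (∼ (∼ x ∨ ∼ y))      ≡⟨ ∼-invol (∼ x ∨ ∼ y) ⟩
    ∼ x ∨ ∼ y              ∎

  module CenteredOperator
    (G : T → T)
    (G-∧ : ∀ x y → G (x ∧ y) ≡ (G x ∧ G y))
    (G-c : G c ≡ c)
    (G-∨ : ∀ x y → G (x ∨ y) ≤ (G x ∨ ∼ (G (∼ y))))
    where

    F : T → T
    F x = ∼ (G (∼ x))

    G-mono : ∀ {x y} → x ≤ y → G x ≤ G y
    G-mono {x} {y} x≤y = trans (sym (G-∧ x y)) (cong G x≤y)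

    F-c : F c ≡ c
    F-c = begin
      ∼ (G (∼ c))  ≡⟨ cong (λ z → ∼ (G z)) ∼-c ⟩
      ∼ (G c)      ≡⟨ cong ∼ G-c ⟩
      ∼ c          ≡⟨ ∼-c ⟩
      c            ∎

    G-∨-c : ∀ x → G (x ∨ c) ≡ (G x ∨ c)
    G-∨-c x = ≤-antisym G[x∨c]≤Gx∨c Gx∨c≤G[x∨c]
      where
      G[x∨c]≤Gx∨c : G (x ∨ c) ≤ (G x ∨ c)
      G[x∨c]≤Gx∨c = trans (cong (λ z → G (x ∨ c) ∧ (G x ∨ z)) (sym F-c)) (G-∨ x c)

      c≤G[x∨c] : c ≤ G (x ∨ c)
      c≤G[x∨c] = trans (cong (_∧ G (x ∨ c)) (sym G-c)) (trans (G-mono (y≤x∨y x c)) G-c)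

      Gx∨c≤G[x∨c] : (G x ∨ c) ≤ G (x ∨ c)
      Gx∨c≤G[x∨c] = ∨-least (G-mono (x≤x∨y x c)) c≤G[x∨c]

    F-∧-c : ∀ x → F (x ∧ c) ≡ (F x ∧ c)
    F-∧-c x = begin
      ∼ (G (∼ (x ∧ c)))  ≡⟨ cong (λ z → ∼ (G z)) (trans (∼-deMorgan-∧ x c) (cong (∼ x ∨_) ∼-c)) ⟩
      ∼ (G (∼ x ∨ c))    ≡⟨ cong ∼ (G-∨-c (∼ x)) ⟩
      ∼ (G (∼ x) ∨ c)    ≡⟨ ∼-deMorgan (G (∼ x)) c ⟩
      F x ∧ ∼ c          ≡⟨ cong (F x ∧_) ∼-c ⟩
      F x ∧ c            ∎

proposition4p4 : ∀ {ℓ} (U : CenteredTenseKIAlgebra ℓ) →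
    let open CenteredTenseKIAlgebra U
        open TenseKIAlgebra 𝐔
        open KIAlgebra 𝐓
    in (F c ≡ c × P c ≡ c)
       × (∀ x → (G (x ∨ c) ≡ (G x ∨ c)) × (H (x ∨ c) ≡ (H x ∨ c)))
       × (∀ x → (F (x ∧ c) ≡ (F x ∧ c)) × (P (x ∧ c) ≡ (P x ∧ c)))
proposition4p4 U =
    (Future.F-c , Past.F-c)
  , (λ x → Future.G-∨-c x , Past.G-∨-c x)
  , (λ x → Future.F-∧-c x , Past.F-∧-c x)
  where
  open CenteredTenseKIAlgebra U
  open TenseKIAlgebra 𝐔
  open KIAlgebraProperties 𝐓
  module Future = CenteredOperator G G-∧ Gc G-∨
  module Past   = CenteredOperator H H-∧ Hc H-∨
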